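{- Let $S\subseteq\mathbb{N}^\mathbb{N}$ with $S_\infty=\emptyset$. Then $G_S$ guesses $S$, i.e. for every $f\in\mathbb{N}^\mathbb{N}$, $\lim_{n\to\infty}G_S(f\upharpoonright n)=\chi_S(f)$.
   Context: $\mathbb{N}^{<\mathbb{N}}$ is the set of finite sequences of naturals; $f\upharpoonright n$ is the length-$n$ initial segment of $f$; $\chi_S$ is the characteristic function of $S$. For $X\subseteq\mathbb{N}^{<\mathbb{N}}$, $[X]$ is the set of $f\in\mathbb{N}^\mathbb{N}$ all of whose finite initial segments lie in $X$. Define $S_\alpha\subseteq\mathbb{N}^{<\mathbb{N}}$ by: $S_0=\mathbb{N}^{<\mathbb{N}}$; $S_\lambda=\bigcap_{\beta<\lambda}S_\beta$ for limit $\lambda$; $S_{\beta+1}=\{x\in S_\beta: \exists x',x''\in[S_\beta] \text{ extending } x \text{ with } x'\in S,\ x''\notin S\}$. Let $\alpha(S)$ be the least $\alpha$ with $S_\alpha=S_{\alpha+1}$ and $S_\infty=S_{\alpha(S)}$. For $\sigma\notin S_\infty$, $\beta(\sigma)$ is the least ordinal with $\sigma\notin S_{\beta(\sigma)}$ (a successor ordinal; $\beta(\sigma)-1$ is its predecessor). When $S_\infty=\emptyset$, every $\sigma$ lies in $S_{\beta(\sigma)-1}\setminus S_{\beta(\sigma)}$, so the extensions of $\sigma$ in $[S_{\beta(\sigma)-1}]$ are either all in $S$ or all outside $S$; define $G_S:\mathbb{N}^{<\mathbb{N}}\to\{0,1\}$ by: (i) if $\sigma$ has no extension in $[S_{\beta(\sigma)-1}]$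 and $\sigma$ has positive length, $G_S(\sigma)=G_S(\sigma^-)$ where $\sigma^-$ is $\sigma$ with its last term removed; (ii) if $\sigma$ has no such extension and is empty, $G_S(\sigma)=0$; (iii) if $\sigma$ has such extensions and all lie in $S$, $G_S(\sigma)=1$; (iv) if $\sigma$ has such extensions and all lie outside $S$, $G_S(\sigma)=0$. -}

module Defs where

open import Data.Nat using (ℕ; zero; suc; _≥_)
open import Data.Bool using (Bool; true; false)
open import Data.List using (List; []; _∷_; map; upTo; length; _∷ʳ_)
open import Data.Product using (Σ; ∃; _×_; _,_)
open import Data.Unit using (⊤)
open import Relation.Nullary using (¬_)
open import Relation.Binary.PropositionalEquality using (_≡_)

Seq : Set
Seq = List ℕ

Baire : Set
Baire = ℕ → ℕ

_↾_ : Baire → ℕ → Seq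
f ↾ n = map f (upTo n)

Extends : Baire → Seq → Set
Extends f x = f ↾ length x ≡ x

Body : (Seq → Set) → Baire → Set
Body X f = ∀ n → X (f ↾ n)

-- Countable ordinals as Brouwer trees; lim s denotes sup of the s n.
data Ord : Set where
  ozero : Ord
  osuc  : Ord → Ord
  olim  : (ℕ → Ord) → Ord

-- The limit stage is the intersection over the approximating sequence, which
-- (the S_α being decreasing) equals ⋂_{β<λ} S_β.
Der : (Baire → Set) → Ord → Seq → Set
Der S ozero    x = ⊤
Der S (osuc a) x =
  Der S a x
  × (Σ Baire λ f → Body (Der S a) f × Extends f x × S f)
  × (Σ Baire λ g → Body (Der S a) g × Extends g x × ¬ S g)
Der S (olim s) x = ∀ n → Der S (s n) x

-- S_∞ = ∅ : the derivative sequence reaches the empty set at some stage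
-- (equivalently, its stable value S_{α(S)} is empty).
SInftyEmpty : (Baire → Set) → Set
SInftyEmpty S = Σ Ord λ α → ∀ x → ¬ Der S α x

HasExt : (Baire → Set) → Ord → Seq → Set
HasExt S γ σ = Σ Baire λ f → Body (Der S γ) f × Extends f σ

-- G satisfies the defining clauses (i)-(iv) of G_S, where γ plays the role of
-- β(σ)-1, i.e. σ ∈ S_γ \ S_{γ+1}.  Bool encodes {0,1} (true = 1).
IsGS : (Baire → Set) → (Seq → Bool) → Set
IsGS S G = ∀ σ γ → Der S γ σ → ¬ Der S (osuc γ) σ →
    (¬ HasExt S γ σ → ∀ τ k → σ ≡ τ ∷ʳ k → G σ ≡ G τ)
  × (¬ HasExt S γ σ → σ ≡ [] → G σ ≡ false)
  × (HasExt S γ σ → (∀ f → Body (Der S γ) f → Extends f σ → S f) → G σ ≡ true)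
  × (HasExt S γ σ → (∀ f → Body (Der S γ) f → Extends f σ → ¬ S f) → G σ ≡ false)

Guesses : (Baire → Set) → (Seq → Bool) → Set
Guesses S G = ∀ f →
    (S f → Σ ℕ λ N → ∀ n → n ≥ N → G (f ↾ n) ≡ true)
  × (¬ S f → Σ ℕ λ N → ∀ n → n ≥ N → G (f ↾ n) ≡ false)

-- Every f leaves the body [S_γ] at a successor stage: f ∈ [S_γ] but some
-- prefix f↾n₀ ∉ S_{γ+1}, and then no longer prefix lies in S_{γ+1} either.
-- For n ≥ n₀ the sequence f↾n is thus in S_γ \ S_{γ+1}, f itself is an
-- extension of it in [S_γ], and since f↾n ∉ S_{γ+1} all such extensions agree
-- with f about membership in S; so clauses (iii)/(iv) force G(f↾n) = χ_S(f).
module Submission where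

open import Defs
open import Level using (0ℓ)
open import Data.Bool using (Bool; true; false)
open import Axiom.ExcludedMiddle using (ExcludedMiddle)
open import Data.Nat using (ℕ; suc; _≤_; _≥_; z≤n; s≤s)
open import Data.List using (_∷_; map; take; upTo; applyUpTo; length)
open import Data.List.Properties using (map-upTo; length-map; length-upTo)
open import Data.Product using (Σ; _×_; _,_; proj₁; proj₂)
open import Data.Empty using (⊥-elim)
open import Data.Unit using (tt)
open import Relation.Nullary using (¬_; yes; no)
open import Relation.Nullary.Decidable using (decidable-stable)
open import Relation.Binary.PropositionalEquality
  using (_≡_; refl; sym; trans; cong; subst; module ≡-Reasoning)
open import Function using (_∘_)
open ≡-Reasoning

take-applyUpTo : ∀ {a} {A : Set a} (f : ℕ → A) {n m} → n ≤ m →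
  take n (applyUpTo f m) ≡ applyUpTo f n
take-applyUpTo f z≤n        = refl
take-applyUpTo f (s≤s n≤m) = cong (f 0 ∷_) (take-applyUpTo (f ∘ suc) n≤m)

take-↾ : ∀ (f : Baire) {n m} → n ≤ m → take n (f ↾ m) ≡ f ↾ n
take-↾ f {n} {m} n≤m = begin
  take n (map f (upTo m))  ≡⟨ cong (take n) (map-upTo f m) ⟩
  take n (applyUpTo f m)   ≡⟨ take-applyUpTo f n≤m ⟩
  applyUpTo f n            ≡⟨ sym (map-upTo f n) ⟩
  f ↾ n                    ∎

↾-agree-≤ : ∀ (f g : Baire) {n m} → g ↾ m ≡ f ↾ m → n ≤ m → g ↾ n ≡ f ↾ n
↾-agree-≤ f g {n} {m} g≡f n≤m = begin
  g ↾ n          ≡⟨ sym (take-↾ g n≤m) ⟩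
  take n (g ↾ m) ≡⟨ cong (take n) g≡f ⟩
  take n (f ↾ m) ≡⟨ take-↾ f n≤m ⟩
  f ↾ n          ∎

length-↾ : ∀ (f : Baire) n → length (f ↾ n) ≡ n
length-↾ f n = trans (length-map f (upTo n)) (length-upTo n)

extends-↾⇒↾-agree : ∀ (f g : Baire) n → Extends g (f ↾ n) → g ↾ n ≡ f ↾ n
extends-↾⇒↾-agree f g n = subst (λ k → g ↾ k ≡ f ↾ n) (length-↾ f n)

↾-agree⇒extends-↾ : ∀ (f g : Baire) n → g ↾ n ≡ f ↾ n → Extends g (f ↾ n)
↾-agree⇒extends-↾ f g n = subst (λ k → g ↾ k ≡ f ↾ n) (sym (length-↾ f n))

extends-own-↾ : ∀ (f : Baire) n → Extends f (f ↾ n)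
extends-own-↾ f n = ↾-agree⇒extends-↾ f f n refl

extends-↾-≤ : ∀ (f g : Baire) {n m} → Extends g (f ↾ m) → n ≤ m → Extends g (f ↾ n)
extends-↾-≤ f g {n} {m} ext n≤m =
  ↾-agree⇒extends-↾ f g n (↾-agree-≤ f g (extends-↾⇒↾-agree f g m ext) n≤m)

Der-↾-≤ : ∀ S α (f : Baire) {n m} → Der S α (f ↾ m) → n ≤ m → Der S α (f ↾ n)
Der-↾-≤ S ozero    f _ _ = tt
Der-↾-≤ S (osuc α) f (d , (g , g∈ , g⊒ , g∈S) , (h , h∈ , h⊒ , h∉S)) n≤m =
    Der-↾-≤ S α f d n≤m
  , (g , g∈ , extends-↾-≤ f g g⊒ n≤m , g∈S)
  , (h , h∈ , extends-↾-≤ f h h⊒ n≤m , h∉S)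
Der-↾-≤ S (olim s) f d n≤m k = Der-↾-≤ S (s k) f (d k) n≤m

no-extension-in-S : ∀ S γ x → Der S γ x → ¬ Der S (osuc γ) x →
  ∀ f → Body (Der S γ) f → Extends f x → ¬ S f →
  ∀ g → Body (Der S γ) g → Extends g x → ¬ S g
no-extension-in-S S γ x x∈ x∉ f f∈ f⊒ f∉S g g∈ g⊒ g∈S =
  x∉ (x∈ , (g , g∈ , g⊒ , g∈S) , (f , f∈ , f⊒ , f∉S))

module Classical (em : ExcludedMiddle 0ℓ) where

  ¬∀⇒∃¬ : {P : ℕ → Set} → ¬ (∀ n → P n) → Σ ℕ λ n → ¬ P n
  ¬∀⇒∃¬ {P} ¬∀P with em {Σ ℕ λ n → ¬ P n}
  ... | yes ∃¬P = ∃¬P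
  ... | no ¬∃¬P = ⊥-elim (¬∀P λ n → decidable-stable em λ ¬Pn → ¬∃¬P (n , ¬Pn))

  all-extensions-in-S : ∀ S γ x → Der S γ x → ¬ Der S (osuc γ) x →
    ∀ f → Body (Der S γ) f → Extends f x → S f →
    ∀ g → Body (Der S γ) g → Extends g x → S g
  all-extensions-in-S S γ x x∈ x∉ f f∈ f⊒ f∈S g g∈ g⊒ =
    decidable-stable em λ g∉S → x∉ (x∈ , (f , f∈ , f⊒ , f∈S) , (g , g∈ , g⊒ , g∉S))

  -- Transfinite descent along the Brouwer tree α; at a limit some branch s m
  -- already excludes f.
  exit-stage : ∀ S (f : Baire) α → ¬ Body (Der S α) f →
    Σ Ord λ γ → Body (Der S γ) f × ¬ Body (Der S (osuc γ)) f
  exit-stage S f ozero    f∉ = ⊥-elim (f∉ λ _ → tt)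
  exit-stage S f (osuc α) f∉ with em {Body (Der S α) f}
  ... | yes f∈ = α , f∈ , f∉
  ... | no f∉′ = exit-stage S f α f∉′
  exit-stage S f (olim s) f∉ =
    let m , f∉sm = ¬∀⇒∃¬ {λ m → Body (Der S (s m)) f} λ f∈ → f∉ λ n m → f∈ m n
    in  exit-stage S f (s m) f∉sm

  eventually-∉-Der : ∀ S α (f : Baire) → ¬ Body (Der S α) f →
    Σ ℕ λ n₀ → ∀ n → n ≥ n₀ → ¬ Der S α (f ↾ n)
  eventually-∉-Der S α f f∉ =
    let n₀ , fn₀∉ = ¬∀⇒∃¬ f∉
    in  n₀ , λ n n≥n₀ fn∈ → fn₀∉ (Der-↾-≤ S α f fn∈ n≥n₀)

  IsGS⇒G-decides-S : ∀ S G → IsGS S G → ∀ σ γ → Der S γ σ → ¬ Der S (osuc γ) σ →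
    ∀ f → Body (Der S γ) f → Extends f σ →
    (S f → G σ ≡ true) × (¬ S f → G σ ≡ false)
  IsGS⇒G-decides-S S G isGS σ γ σ∈ σ∉ f f∈ f⊒ with isGS σ γ σ∈ σ∉
  ... | _ , _ , clause-iii , clause-iv =
      (λ f∈S → clause-iii has-ext (all-extensions-in-S S γ σ σ∈ σ∉ f f∈ f⊒ f∈S))
    , (λ f∉S → clause-iv has-ext (no-extension-in-S S γ σ σ∈ σ∉ f f∈ f⊒ f∉S))
    where
    has-ext : HasExt S γ σ
    has-ext = f , f∈ , f⊒

proposition2p8 : ExcludedMiddle 0ℓ → (S : Baire → Set) → SInftyEmpty S →
    (G : Seq → Bool) → IsGS S G → Guesses S G
proposition2p8 em S (α , Sα-empty) G isGS f
  with Classical.exit-stage em S f α (λ f∈ → Sα-empty (f ↾ 0) (f∈ 0))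
... | γ , f∈ , f∉ with Classical.eventually-∉-Der em S (osuc γ) f f∉
... | n₀ , fn∉ =
    (λ f∈S → n₀ , λ n n≥n₀ → proj₁ (decides n n≥n₀) f∈S)
  , (λ f∉S → n₀ , λ n n≥n₀ → proj₂ (decides n n≥n₀) f∉S)
  where
  decides : ∀ n → n ≥ n₀ → (S f → G (f ↾ n) ≡ true) × (¬ S f → G (f ↾ n) ≡ false)
  decides n n≥n₀ = Classical.IsGS⇒G-decides-S em S G isGS (f ↾ n) γ (f∈ n) (fn∉ n n≥n₀)
                     f f∈ (extends-own-↾ f n)
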